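{- Let $N\in\mathbb{Z}_{\geq2}$ be square-free with $\|\epsilon_N\|=-1$. If $\alpha\in\mathfrak{D}^{+1}_N$ and $\alpha=\ell_\alpha\epsilon_N^{m_\alpha}(\sqrt N)^{\delta_0}$ with $\ell_\alpha,m_\alpha\in\mathbb{Z}$ and $\delta_0\in\{0,1\}$, then \[\ell_\alpha\geq\epsilon_N^{m_\alpha}(\sqrt{N})^{ -\delta_0}\qquad\text{and}\qquad\alpha\geq\epsilon_N^{2m_\alpha}.\]
   Context: An algebraic integer is a $d$-number if the ideal it generates in the ring of all algebraic integers is invariant under $\mathrm{Gal}(\overline{\mathbb{Q}}/\mathbb{Q})$. $\mathfrak{D}_N$ is the set of $d$-numbers in $\mathbb{Q}(\sqrt N)$, $\sigma$ the nontrivial automorphism of $\mathbb{Q}(\sqrt N)$, $\|\cdot\|$ the field norm, $\epsilon_N>1$ the fundamental unit of the ring of integers of $\mathbb{Q}(\sqrt N)$, and $\mathfrak{D}^{+1}_N=\{\alpha\in\mathfrak{D}_N:\alpha\geq\sigma(\alpha)\geq1\}$. When $\|\epsilon_N\|=-1$, every $\alpha\in\mathfrak{D}_N$ can be written uniquely as $\ell_\alpha\epsilon_N^{m_\alpha}(\sqrt N)^{\delta_0}$ with $\ell_\alpha,m_\alpha\in\mathbb{Z}$, $\delta_0\in\{0,1\}$. -}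

module Defs where

open import Data.Nat as ℕ using (ℕ; suc)
open import Data.Nat.Divisibility using (_∣_)
open import Data.Integer as ℤ using (ℤ; +_; -[1+_]; +[1+_]; +0)
open import Data.Rational as ℚ using (ℚ; mkℚ; 0ℚ; 1ℚ)
open import Data.Product using (_×_; Σ; ∃; _,_)
open import Data.Sum using (_⊎_)
open import Relation.Binary.PropositionalEquality using (_≡_)
open import Relation.Nullary using (¬_)

SquareFree : ℕ → Set
SquareFree N = ∀ (d : ℕ) → (d ℕ.* d) ∣ N → d ≡ 1

-- Elements a + b√N of ℚ(√N) (N a fixed square-free integer ≥ 2).
record QF : Set where
  constructor ⟨_,_⟩
  field
    re : ℚ
    im : ℚ
open QF public

module QFOps (N : ℕ) where
  Nq : ℚ
  Nq = (+ N) ℚ./ 1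

  ι : ℚ → QF
  ι q = ⟨ q , 0ℚ ⟩

  ιℤ : ℤ → QF
  ιℤ z = ι (z ℚ./ 1)

  rootN : QF
  rootN = ⟨ 0ℚ , 1ℚ ⟩

  _⊕_ : QF → QF → QF
  ⟨ a , b ⟩ ⊕ ⟨ c , d ⟩ = ⟨ a ℚ.+ c , b ℚ.+ d ⟩

  ⊖_ : QF → QF
  ⊖ ⟨ a , b ⟩ = ⟨ ℚ.- a , ℚ.- b ⟩

  _⊗_ : QF → QF → QF
  ⟨ a , b ⟩ ⊗ ⟨ c , d ⟩ = ⟨ a ℚ.* c ℚ.+ Nq ℚ.* (b ℚ.* d) , a ℚ.* d ℚ.+ b ℚ.* c ⟩

  σ : QF → QF
  σ ⟨ a , b ⟩ = ⟨ a , ℚ.- b ⟩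

  -- field norm ‖x‖ = x σ(x) ∈ ℚ, and trace
  norm : QF → ℚ
  norm ⟨ a , b ⟩ = a ℚ.* a ℚ.- Nq ℚ.* (b ℚ.* b)

  trace : QF → ℚ
  trace ⟨ a , b ⟩ = a ℚ.+ a

  -- reciprocal in ℚ (with 1/0 := 0, only used at nonzero arguments)
  recip : ℚ → ℚ
  recip p@(mkℚ +[1+ _ ] _ _) = ℚ.1/ p
  recip p@(mkℚ -[1+ _ ] _ _) = ℚ.1/ p
  recip (mkℚ +0 _ _) = 0ℚ

  -- multiplicative inverse in ℚ(√N): x⁻¹ = σ(x)/‖x‖ (0⁻¹ := 0)
  inv : QF → QF
  inv x = σ x ⊗ ι (recip (norm x))

  _^ℕ_ : QF → ℕ → QF
  x ^ℕ ℕ.zero = ι 1ℚ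
  x ^ℕ suc n = x ⊗ (x ^ℕ n)

  _^_ : QF → ℤ → QF
  x ^ (+ n) = x ^ℕ n
  x ^ -[1+ n ] = inv x ^ℕ suc n

  -- Order on ℚ(√N) ⊂ ℝ via the real embedding with √N > 0:
  -- a + b√N ≥ 0 written out in terms of rationals.
  NonNeg : QF → Set
  NonNeg ⟨ a , b ⟩ =
      (0ℚ ℚ.≤ a × 0ℚ ℚ.≤ b)
    ⊎ ((0ℚ ℚ.≤ a × b ℚ.< 0ℚ) × Nq ℚ.* (b ℚ.* b) ℚ.≤ a ℚ.* a)
    ⊎ ((a ℚ.< 0ℚ × 0ℚ ℚ.< b) × a ℚ.* a ℚ.≤ Nq ℚ.* (b ℚ.* b))

  _≤F_ : QF → QF → Set
  x ≤F y = NonNeg (y ⊕ (⊖ x))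

  _<F_ : QF → QF → Set
  x <F y = x ≤F y × ¬ (x ≡ y)

  -- algebraic integers of ℚ(√N): roots of the monic integer polynomial
  -- X² - tr(x) X + ‖x‖, i.e. trace and norm are rational integers.
  IsIntℚ : ℚ → Set
  IsIntℚ q = ℚ.denominatorℕ q ≡ 1

  InOK : QF → Set
  InOK x = IsIntℚ (trace x) × IsIntℚ (norm x)

  IsUnit : QF → Set
  IsUnit x = InOK x × Σ QF (λ y → InOK y × (x ⊗ y) ≡ ι 1ℚ)

  IsFundamentalUnit : QF → Set
  IsFundamentalUnit ε =
    IsUnit ε × (ι 1ℚ <F ε) × (∀ (u : QF) → IsUnit u → ι 1ℚ <F u → ε ≤F u)

-- Write u = ε^m and r = √N^δ, so α = ℓ·u·r.  The automorphism σ acts on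
-- each factor by a sign: σ(ℓ) = ℓ, u·σ(u) = ‖u‖ = ±1 and σ(r) = ±r.  Hence
--
--     σ(α)·u² = ±α.
--
-- Since σ(α) ≥ 1 > 0 and u² ≥ 0 the sign "-" would give α - σ(α) < 0,
-- contradicting α ≥ σ(α); so α = σ(α)·u² ≥ u² = ε^{2m}.  Finally
-- (ℓ - u·r⁻¹)·(u·r) = α - u² ≥ 0 with u·r > 0, whence ℓ ≥ u·r⁻¹.
--
-- The proposition is then a
-- short combination of these facts.

module Submission where

open import Defs
open import Data.Nat as ℕ using (ℕ; zero; suc; _≤_)
import Data.Nat.Properties as ℕP
open import Data.Nat.Divisibility using (_∣_; divides; ∣-refl)
open import Data.Nat.Coprimality as Coprimality using (Coprime; coprime-divisor)
open import Data.Integer as ℤ using (ℤ; +_; -[1+_]; +[1+_])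
import Data.Integer.Properties as ℤP
open import Data.Rational as ℚ using (ℚ; mkℚ; 0ℚ; 1ℚ; _+_; _*_; _-_; -_; _<_) renaming (_≤_ to _≤ℚ_)
import Data.Rational.Properties as ℚP
import Data.Rational.Unnormalised as ℚᵘ
import Data.Rational.Unnormalised.Properties as ℚᵘP
open import Data.Rational.Solver using (module +-*-Solver)
open import Data.Product using (_×_; _,_; Σ)
open import Data.Sum using (_⊎_; inj₁; inj₂)
open import Data.Empty using (⊥; ⊥-elim)
open import Relation.Nullary using (¬_; yes; no; recompute)
open import Relation.Binary.PropositionalEquality
open import Relation.Binary.Definitions using (tri<; tri≈; tri>)
open import Algebra.Bundles using (CommutativeRing)
import Algebra.Properties.Ring as RingProperties
import Algebra.Properties.CommutativeSemigroup as CommutativeSemigroupProperties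
import Algebra.Solver.Ring.NaturalCoefficients.Default as SemiringSolver

module _ where
  open +-*-Solver

  *-pos : ∀ {x y} → 0ℚ < x → 0ℚ < y → 0ℚ < x * y
  *-pos {x} {y} 0<x 0<y =
    ℚP.positive⁻¹ _ {{ℚP.pos*pos⇒pos x {{ℚ.positive 0<x}} y {{ℚ.positive 0<y}}}}

  *-nonneg : ∀ {x y} → 0ℚ ≤ℚ x → 0ℚ ≤ℚ y → 0ℚ ≤ℚ x * y
  *-nonneg {x} {y} 0≤x 0≤y =
    ℚP.nonNegative⁻¹ _ {{ℚP.nonNeg*nonNeg⇒nonNeg x {{ℚ.nonNegative 0≤x}} y {{ℚ.nonNegative 0≤y}}}}

  neg-pos : ∀ {x} → x < 0ℚ → 0ℚ < - x
  neg-pos = ℚP.neg-antimono-<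

  neg-neg : ∀ {x} → 0ℚ < x → - x < 0ℚ
  neg-neg = ℚP.neg-antimono-<

  neg-neg⇒pos : ∀ {x} → - x < 0ℚ → 0ℚ < x
  neg-neg⇒pos {x} h = subst (0ℚ <_) (solve 1 (λ x → :- (:- x) := x) refl x) (neg-pos h)

  nonneg∧≢0⇒pos : ∀ {x} → 0ℚ ≤ℚ x → x ≢ 0ℚ → 0ℚ < x
  nonneg∧≢0⇒pos {x} 0≤x x≢0 =
    ℚP.positive⁻¹ _ {{ℚP.nonNeg∧nonZero⇒pos x {{ℚ.nonNegative 0≤x}} {{ℚ.≢-nonZero x≢0}}}}

  pos-neg⇒neg : ∀ {x} → 0ℚ < - x → x < 0ℚ
  pos-neg⇒neg {x} h = subst (_< 0ℚ) (solve 1 (λ x → :- (:- x) := x) refl x) (neg-neg h)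

  <⇒≱ : ∀ {x y} → x < y → ¬ (y ≤ℚ x)
  <⇒≱ x<y y≤x = ℚP.<-irrefl refl (ℚP.<-≤-trans x<y y≤x)

  square-pos : ∀ {x} → x ≢ 0ℚ → 0ℚ < x * x
  square-pos {x} x≢0 with ℚP.<-cmp x 0ℚ
  ... | tri< x<0 _ _ = subst (0ℚ <_) (solve 1 (λ x → (:- x) :* (:- x) := x :* x) refl x)
                         (*-pos (neg-pos x<0) (neg-pos x<0))
  ... | tri≈ _ x≡0 _ = ⊥-elim (x≢0 x≡0)
  ... | tri> _ _ x>0 = *-pos x>0 x>0

  square-nonneg : ∀ x → 0ℚ ≤ℚ x * x
  square-nonneg x with x ℚP.≟ 0ℚ
  ... | yes refl = ℚP.≤-refl
  ... | no  x≢0  = ℚP.<⇒≤ (square-pos x≢0)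

  0<-⇒< : ∀ {x y} → 0ℚ < y - x → x < y
  0<-⇒< {x} {y} h = subst₂ _<_ (ℚP.+-identityˡ x)
                      (solve 2 (λ x y → y :- x :+ x := y) refl x y) (ℚP.+-monoˡ-< x h)

  dominates : ∀ U V → 0ℚ < U → 0ℚ < U * U - V * V → 0ℚ < U + V
  dominates U V 0<U h with ℚP.<-cmp (U + V) 0ℚ
  ... | tri> _ _ 0<U+V = 0<U+V
  ... | tri≈ _ U+V≡0 _ = ⊥-elim (ℚP.<-irrefl refl (subst (0ℚ <_) factored h))
    where
      factored : U * U - V * V ≡ 0ℚ
      factored = begin
        U * U - V * V     ≡⟨ solve 2 (λ U V → U :* U :- V :* V := (U :+ V) :* (U :- V)) refl U V ⟩
        (U + V) * (U - V) ≡⟨ cong (_* (U - V)) U+V≡0 ⟩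
        0ℚ * (U - V)      ≡⟨ ℚP.*-zeroˡ (U - V) ⟩
        0ℚ                ∎
        where open ≡-Reasoning
  ... | tri< U+V<0 _ _ = ⊥-elim (ℚP.<-asym h (subst (_< 0ℚ) factored (neg-neg product-pos)))
    where
      -- U - V = 2U - (U + V) > 0, so (U + V)(U - V) < 0
      product-pos : 0ℚ < - (U + V) * ((U + U) - (U + V))
      product-pos = *-pos (neg-pos U+V<0) (ℚP.+-mono-< (ℚP.+-mono-< 0<U 0<U) (neg-pos U+V<0))
      factored : - (- (U + V) * ((U + U) - (U + V))) ≡ U * U - V * V
      factored = solve 2 (λ U V → :- ((:- (U :+ V)) :* ((U :+ U) :- (U :+ V))) := U :* U :- V :* V) refl U V

module Arithmetic (N : ℕ) where
  open QFOps N

  0F 1F : QF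
  0F = ι 0ℚ
  1F = ι 1ℚ

  open +-*-Solver

  private
    ⟨⟩-cong : ∀ {a b c d} → a ≡ c → b ≡ d → ⟨ a , b ⟩ ≡ ⟨ c , d ⟩
    ⟨⟩-cong = cong₂ ⟨_,_⟩

  ⊕-assoc : ∀ x y z → (x ⊕ y) ⊕ z ≡ x ⊕ (y ⊕ z)
  ⊕-assoc ⟨ a , b ⟩ ⟨ c , d ⟩ ⟨ e , f ⟩ = ⟨⟩-cong (ℚP.+-assoc a c e) (ℚP.+-assoc b d f)

  ⊕-comm : ∀ x y → x ⊕ y ≡ y ⊕ x
  ⊕-comm ⟨ a , b ⟩ ⟨ c , d ⟩ = ⟨⟩-cong (ℚP.+-comm a c) (ℚP.+-comm b d)

  ⊕-identityˡ : ∀ x → 0F ⊕ x ≡ x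
  ⊕-identityˡ ⟨ a , b ⟩ = ⟨⟩-cong (ℚP.+-identityˡ a) (ℚP.+-identityˡ b)

  ⊕-identityʳ : ∀ x → x ⊕ 0F ≡ x
  ⊕-identityʳ ⟨ a , b ⟩ = ⟨⟩-cong (ℚP.+-identityʳ a) (ℚP.+-identityʳ b)

  ⊖-inverseˡ : ∀ x → (⊖ x) ⊕ x ≡ 0F
  ⊖-inverseˡ ⟨ a , b ⟩ = ⟨⟩-cong (ℚP.+-inverseˡ a) (ℚP.+-inverseˡ b)

  ⊖-inverseʳ : ∀ x → x ⊕ (⊖ x) ≡ 0F
  ⊖-inverseʳ ⟨ a , b ⟩ = ⟨⟩-cong (ℚP.+-inverseʳ a) (ℚP.+-inverseʳ b)

  ⊗-assoc : ∀ x y z → (x ⊗ y) ⊗ z ≡ x ⊗ (y ⊗ z)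
  ⊗-assoc ⟨ a , b ⟩ ⟨ c , d ⟩ ⟨ e , f ⟩ = ⟨⟩-cong
    (solve 7 (λ a b c d e f n → (a :* c :+ n :* (b :* d)) :* e :+ n :* ((a :* d :+ b :* c) :* f)
                             := a :* (c :* e :+ n :* (d :* f)) :+ n :* (b :* (c :* f :+ d :* e))) refl a b c d e f Nq)
    (solve 7 (λ a b c d e f n → (a :* c :+ n :* (b :* d)) :* f :+ (a :* d :+ b :* c) :* e
                             := a :* (c :* f :+ d :* e) :+ b :* (c :* e :+ n :* (d :* f))) refl a b c d e f Nq)

  ⊗-comm : ∀ x y → x ⊗ y ≡ y ⊗ x
  ⊗-comm ⟨ a , b ⟩ ⟨ c , d ⟩ = ⟨⟩-cong
    (solve 5 (λ a b c d n → a :* c :+ n :* (b :* d) := c :* a :+ n :* (d :* b)) refl a b c d Nq)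
    (solve 4 (λ a b c d → a :* d :+ b :* c := c :* b :+ d :* a) refl a b c d)

  ⊗-identityˡ : ∀ x → 1F ⊗ x ≡ x
  ⊗-identityˡ ⟨ a , b ⟩ = ⟨⟩-cong
    (solve 3 (λ a b n → con 1ℚ :* a :+ n :* (con 0ℚ :* b) := a) refl a b Nq)
    (solve 2 (λ a b → con 1ℚ :* b :+ con 0ℚ :* a := b) refl a b)

  ⊗-identityʳ : ∀ x → x ⊗ 1F ≡ x
  ⊗-identityʳ x = trans (⊗-comm x 1F) (⊗-identityˡ x)

  ⊗-distribˡ-⊕ : ∀ x y z → x ⊗ (y ⊕ z) ≡ (x ⊗ y) ⊕ (x ⊗ z)
  ⊗-distribˡ-⊕ ⟨ a , b ⟩ ⟨ c , d ⟩ ⟨ e , f ⟩ = ⟨⟩-cong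
    (solve 7 (λ a b c d e f n → a :* (c :+ e) :+ n :* (b :* (d :+ f))
                             := (a :* c :+ n :* (b :* d)) :+ (a :* e :+ n :* (b :* f))) refl a b c d e f Nq)
    (solve 6 (λ a b c d e f → a :* (d :+ f) :+ b :* (c :+ e)
                             := (a :* d :+ b :* c) :+ (a :* f :+ b :* e)) refl a b c d e f)

  ⊗-distribʳ-⊕ : ∀ x y z → (y ⊕ z) ⊗ x ≡ (y ⊗ x) ⊕ (z ⊗ x)
  ⊗-distribʳ-⊕ x y z = trans (⊗-comm (y ⊕ z) x)
    (trans (⊗-distribˡ-⊕ x y z) (cong₂ _⊕_ (⊗-comm x y) (⊗-comm x z)))

  QF-commutativeRing : CommutativeRing _ _
  QF-commutativeRing = record
    { Carrier = QF ; _≈_ = _≡_ ; _+_ = _⊕_ ; _*_ = _⊗_ ; -_ = ⊖_ ; 0# = 0F ; 1# = 1F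
    ; isCommutativeRing = record
      { isRing = record
        { +-isAbelianGroup = record
          { isGroup = record
            { isMonoid = record
              { isSemigroup = record
                { isMagma = record { isEquivalence = isEquivalence ; ∙-cong = cong₂ _⊕_ }
                ; assoc = ⊕-assoc }
              ; identity = ⊕-identityˡ , ⊕-identityʳ }
            ; inverse = ⊖-inverseˡ , ⊖-inverseʳ
            ; ⁻¹-cong = cong ⊖_ }
          ; comm = ⊕-comm }
        ; *-cong = cong₂ _⊗_
        ; *-assoc = ⊗-assoc
        ; *-identity = ⊗-identityˡ , ⊗-identityʳ
        ; distrib = ⊗-distribˡ-⊕ , ⊗-distribʳ-⊕ }
      ; *-comm = ⊗-comm } }

  module QF-Solver = SemiringSolver (CommutativeRing.commutativeSemiring QF-commutativeRing)
  open RingProperties (CommutativeRing.ring QF-commutativeRing) public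
    using (-‿distribˡ-*; -‿distribʳ-*; -‿involutive; -1*x≈-x; [y-z]x≈yx-zx)
  open CommutativeSemigroupProperties (CommutativeRing.*-commutativeSemigroup QF-commutativeRing) public
    using () renaming (interchange to ⊗-interchange; x∙yz≈y∙xz to ⊗-left-comm)
  open CommutativeRing QF-commutativeRing public
    using () renaming (zeroˡ to ⊗-zeroˡ; zeroʳ to ⊗-zeroʳ)

  σ-⊗ : ∀ x y → σ (x ⊗ y) ≡ σ x ⊗ σ y
  σ-⊗ ⟨ a , b ⟩ ⟨ c , d ⟩ = ⟨⟩-cong
    (solve 5 (λ a b c d n → a :* c :+ n :* (b :* d) := a :* c :+ n :* ((:- b) :* (:- d))) refl a b c d Nq)
    (solve 4 (λ a b c d → :- (a :* d :+ b :* c) := a :* (:- d) :+ (:- b) :* c) refl a b c d)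

  ⊗-σ : ∀ x → x ⊗ σ x ≡ ι (norm x)
  ⊗-σ ⟨ a , b ⟩ = ⟨⟩-cong
    (solve 3 (λ a b n → a :* a :+ n :* (b :* (:- b)) := a :* a :- n :* (b :* b)) refl a b Nq)
    (solve 2 (λ a b → a :* (:- b) :+ b :* a := con 0ℚ) refl a b)

  ι-⊗ : ∀ p q → ι p ⊗ ι q ≡ ι (p * q)
  ι-⊗ p q = ⟨⟩-cong
    (solve 3 (λ p q n → p :* q :+ n :* (con 0ℚ :* con 0ℚ) := p :* q) refl p q Nq)
    (solve 2 (λ p q → p :* con 0ℚ :+ con 0ℚ :* q := con 0ℚ) refl p q)

  norm-⊗ : ∀ x y → norm (x ⊗ y) ≡ norm x * norm y
  norm-⊗ ⟨ a , b ⟩ ⟨ c , d ⟩ = solve 5 (λ a b c d n →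
      (a :* c :+ n :* (b :* d)) :* (a :* c :+ n :* (b :* d)) :- n :* ((a :* d :+ b :* c) :* (a :* d :+ b :* c))
      := (a :* a :- n :* (b :* b)) :* (c :* c :- n :* (d :* d))) refl a b c d Nq

  norm-⊖ : ∀ x → norm (⊖ x) ≡ norm x
  norm-⊖ ⟨ a , b ⟩ = solve 3 (λ a b n →
    (:- a) :* (:- a) :- n :* ((:- b) :* (:- b)) := a :* a :- n :* (b :* b)) refl a b Nq

  norm-1 : norm 1F ≡ 1ℚ
  norm-1 = solve 1 (λ n → con 1ℚ :* con 1ℚ :- n :* (con 0ℚ :* con 0ℚ) := con 1ℚ) refl Nq

  norm-rootN : norm rootN ≡ - Nq
  norm-rootN = solve 1 (λ n → con 0ℚ :* con 0ℚ :- n :* (con 1ℚ :* con 1ℚ) := :- n) refl Nq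

  σ-rootN : σ rootN ≡ ι (- 1ℚ) ⊗ rootN
  σ-rootN = ⟨⟩-cong
    (solve 1 (λ n → con 0ℚ := con (- 1ℚ) :* con 0ℚ :+ n :* (con 0ℚ :* con 1ℚ)) refl Nq)
    (solve 0 (:- con 1ℚ := con (- 1ℚ) :* con 1ℚ :+ con 0ℚ :* con 0ℚ) refl)

  ⊕-⊖-cancel : ∀ x y → y ⊕ (x ⊕ (⊖ y)) ≡ x
  ⊕-⊖-cancel ⟨ a , b ⟩ ⟨ c , d ⟩ = ⟨⟩-cong
    (solve 2 (λ a c → c :+ (a :+ :- c) := a) refl a c)
    (solve 2 (λ b d → d :+ (b :+ :- d) := b) refl b d)

  ⊕-⊖-swap : ∀ x y → y ⊕ (⊖ x) ≡ ⊖ (x ⊕ (⊖ y))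
  ⊕-⊖-swap ⟨ a , b ⟩ ⟨ c , d ⟩ = ⟨⟩-cong
    (solve 2 (λ a c → c :+ :- a := :- (a :+ :- c)) refl a c)
    (solve 2 (λ b d → d :+ :- b := :- (b :+ :- d)) refl b d)

  ⊖-square : ∀ x → (⊖ x) ⊗ (⊖ x) ≡ x ⊗ x
  ⊖-square x = begin
    (⊖ x) ⊗ (⊖ x)  ≡⟨ sym (-‿distribˡ-* x (⊖ x)) ⟩
    ⊖ (x ⊗ (⊖ x))  ≡⟨ cong ⊖_ (sym (-‿distribʳ-* x x)) ⟩
    ⊖ (⊖ (x ⊗ x))  ≡⟨ -‿involutive (x ⊗ x) ⟩
    x ⊗ x          ∎
    where open ≡-Reasoning

module Powers (N : ℕ) where
  open QFOps N
  open Arithmetic N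
  open QF-Solver using (solve; _:*_; _:=_)

  recip-inverse : ∀ q → q ≢ 0ℚ → q * recip q ≡ 1ℚ
  recip-inverse q@(mkℚ +[1+ _ ] _ _) _    = ℚP.*-inverseʳ q
  recip-inverse q@(mkℚ -[1+ _ ] _ _) _    = ℚP.*-inverseʳ q
  recip-inverse q@(mkℚ (+ zero) _ _) q≢0 = ⊥-elim (q≢0 (ℚP.↥p≡0⇒p≡0 q refl))

  inv-inverse : ∀ x → norm x ≢ 0ℚ → x ⊗ inv x ≡ 1F
  inv-inverse x ‖x‖≢0 = begin
    x ⊗ (σ x ⊗ ι r)            ≡⟨ sym (⊗-assoc x (σ x) (ι r)) ⟩
    (x ⊗ σ x) ⊗ ι r            ≡⟨ cong (_⊗ ι r) (⊗-σ x) ⟩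
    ι (norm x) ⊗ ι r           ≡⟨ ι-⊗ (norm x) r ⟩
    ι (norm x * r)             ≡⟨ cong ι (recip-inverse (norm x) ‖x‖≢0) ⟩
    1F                         ∎
    where
      open ≡-Reasoning
      r = recip (norm x)

  ^ℕ-+ : ∀ x a b → x ^ℕ (a ℕ.+ b) ≡ (x ^ℕ a) ⊗ (x ^ℕ b)
  ^ℕ-+ x zero    b = sym (⊗-identityˡ _)
  ^ℕ-+ x (suc a) b = trans (cong (x ⊗_) (^ℕ-+ x a b)) (sym (⊗-assoc x _ _))

  ^ℕ-distrib-⊗ : ∀ x y n → (x ⊗ y) ^ℕ n ≡ (x ^ℕ n) ⊗ (y ^ℕ n)
  ^ℕ-distrib-⊗ x y zero    = sym (⊗-identityˡ 1F)
  ^ℕ-distrib-⊗ x y (suc n) = begin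
    (x ⊗ y) ⊗ ((x ⊗ y) ^ℕ n)          ≡⟨ cong ((x ⊗ y) ⊗_) (^ℕ-distrib-⊗ x y n) ⟩
    (x ⊗ y) ⊗ ((x ^ℕ n) ⊗ (y ^ℕ n))   ≡⟨ ⊗-interchange x y (x ^ℕ n) (y ^ℕ n) ⟩
    (x ⊗ (x ^ℕ n)) ⊗ (y ⊗ (y ^ℕ n))   ∎
    where open ≡-Reasoning

  1^ℕ : ∀ n → 1F ^ℕ n ≡ 1F
  1^ℕ zero    = refl
  1^ℕ (suc n) = trans (⊗-identityˡ _) (1^ℕ n)

  ^ℕ-inverse : ∀ x y n → x ⊗ y ≡ 1F → (x ^ℕ n) ⊗ (y ^ℕ n) ≡ 1F
  ^ℕ-inverse x y n xy≡1 = trans (sym (^ℕ-distrib-⊗ x y n)) (trans (cong (_^ℕ n) xy≡1) (1^ℕ n))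

  ^-double : ∀ x m → x ^ (+ 2 ℤ.* m) ≡ (x ^ m) ⊗ (x ^ m)
  ^-double x m rewrite ℤP.*-distribʳ-+ m (+ 1) (+ 1) | ℤP.*-identityˡ m = go m
    where
      go : ∀ m → x ^ (m ℤ.+ m) ≡ (x ^ m) ⊗ (x ^ m)
      go (+ n)    = ^ℕ-+ x n n
      go -[1+ n ] = trans (cong (λ k → inv x ^ℕ suc k) (sym (ℕP.+-suc n n))) (^ℕ-+ (inv x) (suc n) (suc n))

  ^-neg : ∀ x n → x ^ (ℤ.- (+ n)) ≡ inv x ^ℕ n
  ^-neg x zero    = refl
  ^-neg x (suc n) = refl

  ^-neg-cancel : ∀ x n → norm x ≢ 0ℚ → (x ^ (ℤ.- (+ n))) ⊗ (x ^ℕ n) ≡ 1F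
  ^-neg-cancel x n ‖x‖≢0 = begin
    (x ^ (ℤ.- (+ n))) ⊗ (x ^ℕ n) ≡⟨ cong (_⊗ (x ^ℕ n)) (^-neg x n) ⟩
    (inv x ^ℕ n) ⊗ (x ^ℕ n)       ≡⟨ ⊗-comm (inv x ^ℕ n) (x ^ℕ n) ⟩
    (x ^ℕ n) ⊗ (inv x ^ℕ n)       ≡⟨ ^ℕ-inverse x (inv x) n (inv-inverse x ‖x‖≢0) ⟩
    1F                            ∎
    where open ≡-Reasoning

  Sign : ℚ → Set
  Sign s = s ≡ 1ℚ ⊎ s ≡ - 1ℚ

  Sign-* : ∀ {s t} → Sign s → Sign t → Sign (s * t)
  Sign-* (inj₁ refl) (inj₁ refl) = inj₁ refl
  Sign-* (inj₁ refl) (inj₂ refl) = inj₂ refl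
  Sign-* (inj₂ refl) (inj₁ refl) = inj₂ refl
  Sign-* (inj₂ refl) (inj₂ refl) = inj₁ refl

  Sign≢0 : ∀ {s} → Sign s → s ≢ 0ℚ
  Sign≢0 (inj₁ refl) ()
  Sign≢0 (inj₂ refl) ()

  Sign-inverse : ∀ {s} t → Sign s → s * t ≡ 1ℚ → Sign t
  Sign-inverse t (inj₁ refl) st≡1 = inj₁ (trans (sym (ℚP.*-identityˡ t)) st≡1)
  Sign-inverse t (inj₂ refl) st≡1 = inj₂ (begin
    t                    ≡⟨ sym (ℚP.*-identityˡ t) ⟩
    1ℚ * t               ≡⟨ ℚP.*-assoc (- 1ℚ) (- 1ℚ) t ⟩
    - 1ℚ * (- 1ℚ * t)    ≡⟨ cong (- 1ℚ *_) st≡1 ⟩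
    - 1ℚ                 ∎)
    where open ≡-Reasoning

  Sign-norm-^ℕ : ∀ x n → Sign (norm x) → Sign (norm (x ^ℕ n))
  Sign-norm-^ℕ x zero    _     = inj₁ norm-1
  Sign-norm-^ℕ x (suc n) ‖x‖±1 =
    subst Sign (sym (norm-⊗ x (x ^ℕ n))) (Sign-* ‖x‖±1 (Sign-norm-^ℕ x n ‖x‖±1))

  Sign-norm-^ : ∀ x m → Sign (norm x) → Sign (norm (x ^ m))
  Sign-norm-^ x (+ n)    ‖x‖±1 = Sign-norm-^ℕ x n ‖x‖±1
  Sign-norm-^ x -[1+ n ] ‖x‖±1 = Sign-norm-^ℕ (inv x) (suc n) ‖x⁻¹‖±1
    where
      ‖x⁻¹‖±1 : Sign (norm (inv x))
      ‖x⁻¹‖±1 = Sign-inverse (norm (inv x)) ‖x‖±1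
        (trans (sym (norm-⊗ x (inv x))) (trans (cong norm (inv-inverse x (Sign≢0 ‖x‖±1))) norm-1))

  σ-rootN^ℕ : ∀ n → Σ ℚ λ s → Sign s × σ (rootN ^ℕ n) ≡ ι s ⊗ (rootN ^ℕ n)
  σ-rootN^ℕ zero    = 1ℚ , inj₁ refl , sym (⊗-identityˡ 1F)
  σ-rootN^ℕ (suc n) with σ-rootN^ℕ n
  ... | s , s±1 , σrⁿ = - 1ℚ * s , Sign-* (inj₂ refl) s±1 , (begin
    σ (rootN ⊗ rⁿ)                    ≡⟨ σ-⊗ rootN rⁿ ⟩
    σ rootN ⊗ σ rⁿ                    ≡⟨ cong₂ _⊗_ σ-rootN σrⁿ ⟩
    (ι (- 1ℚ) ⊗ rootN) ⊗ (ι s ⊗ rⁿ)  ≡⟨ ⊗-interchange (ι (- 1ℚ)) rootN (ι s) rⁿ ⟩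
    (ι (- 1ℚ) ⊗ ι s) ⊗ (rootN ⊗ rⁿ)  ≡⟨ cong (_⊗ (rootN ⊗ rⁿ)) (ι-⊗ (- 1ℚ) s) ⟩
    ι (- 1ℚ * s) ⊗ (rootN ⊗ rⁿ)      ∎)
    where
      open ≡-Reasoning
      rⁿ = rootN ^ℕ n

  -- If σ fixes L and multiplies r by s, then for α = L·u·r one has
  -- σ(α)·u² = (‖u‖·s)·α: conjugating u amounts to dividing by u up to ‖u‖.
  conjugate-times-square : ∀ L u r s → σ L ≡ L → σ r ≡ ι s ⊗ r →
    σ (L ⊗ (u ⊗ r)) ⊗ (u ⊗ u) ≡ ι (norm u * s) ⊗ (L ⊗ (u ⊗ r))
  conjugate-times-square L u r s σL σr = begin
    σ (L ⊗ (u ⊗ r)) ⊗ (u ⊗ u)           ≡⟨ cong (_⊗ (u ⊗ u)) (trans (σ-⊗ L (u ⊗ r)) (cong (σ L ⊗_) (σ-⊗ u r))) ⟩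
    (σ L ⊗ (σ u ⊗ σ r)) ⊗ (u ⊗ u)       ≡⟨ cong₂ (λ a b → (a ⊗ (σ u ⊗ b)) ⊗ (u ⊗ u)) σL σr ⟩
    (L ⊗ (σ u ⊗ (ι s ⊗ r))) ⊗ (u ⊗ u)   ≡⟨ solve 5 (λ L u v S r → (L :* (v :* (S :* r))) :* (u :* u)
                                                := ((u :* v) :* S) :* (L :* (u :* r))) refl L u (σ u) (ι s) r ⟩
    ((u ⊗ σ u) ⊗ ι s) ⊗ (L ⊗ (u ⊗ r))   ≡⟨ cong (λ a → (a ⊗ ι s) ⊗ (L ⊗ (u ⊗ r))) (⊗-σ u) ⟩
    (ι (norm u) ⊗ ι s) ⊗ (L ⊗ (u ⊗ r))  ≡⟨ cong (_⊗ (L ⊗ (u ⊗ r))) (ι-⊗ (norm u) s) ⟩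
    ι (norm u * s) ⊗ (L ⊗ (u ⊗ r))      ∎
    where open ≡-Reasoning

module Order (N : ℕ) (N≥2 : 2 ℕ.≤ N) (sf : SquareFree N) where
  open QFOps N
  open Arithmetic N
  open Powers N
  open +-*-Solver

  -- √N is irrational: m² = N·d² with m, d coprime forces d = 1 and then
  -- m² = N, which square-freeness and N ≥ 2 forbid.
  private
    no-coprime-root : ∀ m d → Coprime m d → m ℕ.* m ≢ N ℕ.* (d ℕ.* d)
    no-coprime-root m d m⊥d m²≡Nd² = ℕP.<-irrefl (sym N≡1) N≥2
      where
        d∣m : d ∣ m
        d∣m = coprime-divisor (Coprimality.sym m⊥d)
                (divides (N ℕ.* d) (trans m²≡Nd² (sym (ℕP.*-assoc N d d))))
        d≡1 : d ≡ 1
        d≡1 = m⊥d (d∣m , ∣-refl)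
        m²≡N : m ℕ.* m ≡ N
        m²≡N = trans m²≡Nd² (trans (cong (λ k → N ℕ.* (k ℕ.* k)) d≡1) (ℕP.*-identityʳ N))
        m≡1 : m ≡ 1
        m≡1 = sf m (divides 1 (trans (sym m²≡N) (sym (ℕP.*-identityˡ (m ℕ.* m)))))
        N≡1 : N ≡ 1
        N≡1 = trans (sym m²≡N) (cong (λ k → k ℕ.* k) m≡1)

  -- in lowest terms q = n/d, q² = N reads |n|² = N·d² in ℕ
  no-rational-root : ∀ q → q * q ≢ Nq
  no-rational-root q@(mkℚ n d-1 n⊥d) q²≡N
    with ℚᵘP.≃-trans (ℚᵘP.≃-sym (ℚP.toℚᵘ-homo-* q q))
           (ℚP.toℚᵘ-cong (trans q²≡N (ℚP.normalize-coprime (Coprimality.sym (Coprimality.1-coprimeTo N)))))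
  ... | ℚᵘ.*≡* cross = no-coprime-root ℤ.∣ n ∣ (suc d-1) (recompute (Coprimality.coprime? _ _) n⊥d) (begin
    ℤ.∣ n ∣ ℕ.* ℤ.∣ n ∣               ≡⟨ sym (ℤP.abs-* n n) ⟩
    ℤ.∣ n ℤ.* n ∣                     ≡⟨ cong ℤ.∣_∣ (sym (ℤP.*-identityʳ (n ℤ.* n))) ⟩
    ℤ.∣ n ℤ.* n ℤ.* + 1 ∣             ≡⟨ cong ℤ.∣_∣ cross ⟩
    ℤ.∣ + N ℤ.* + (suc d-1 ℕ.* suc d-1) ∣ ≡⟨ ℤP.abs-* (+ N) (+ (suc d-1 ℕ.* suc d-1)) ⟩
    N ℕ.* (suc d-1 ℕ.* suc d-1)       ∎)
    where open ≡-Reasoning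

  irrational : ∀ a b → a * a ≡ Nq * (b * b) → b ≡ 0ℚ
  irrational a b a²≡Nb² with b ℚP.≟ 0ℚ
  ... | yes b≡0 = b≡0
  ... | no  b≢0 = ⊥-elim (no-rational-root (a * b⁻¹) (begin
    (a * b⁻¹) * (a * b⁻¹)       ≡⟨ solve 2 (λ a i → (a :* i) :* (a :* i) := (a :* a) :* (i :* i)) refl a b⁻¹ ⟩
    (a * a) * (b⁻¹ * b⁻¹)       ≡⟨ cong (_* (b⁻¹ * b⁻¹)) a²≡Nb² ⟩
    (Nq * (b * b)) * (b⁻¹ * b⁻¹) ≡⟨ solve 3 (λ n b i → (n :* (b :* b)) :* (i :* i) := n :* ((b :* i) :* (b :* i))) refl Nq b b⁻¹ ⟩
    Nq * ((b * b⁻¹) * (b * b⁻¹)) ≡⟨ cong (λ k → Nq * (k * k)) (ℚP.*-inverseʳ b) ⟩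
    Nq * (1ℚ * 1ℚ)              ≡⟨ ℚP.*-identityʳ Nq ⟩
    Nq                          ∎))
    where
      open ≡-Reasoning
      instance _ = ℚ.≢-nonZero b≢0
      b⁻¹ = ℚ.1/ b

  Nq-pos : 0ℚ < Nq
  Nq-pos = ℚP.positive⁻¹ _ {{ℚP.normalize-pos N 1 {{_}} {{ℕ.>-nonZero (ℕP.<-≤-trans (ℕ.s≤s ℕ.z≤n) N≥2)}}}}

  Nb²-nonneg : ∀ b → 0ℚ ≤ℚ Nq * (b * b)
  Nb²-nonneg b = *-nonneg (ℚP.<⇒≤ Nq-pos) (square-nonneg b)

  norm-pos⇒ : ∀ a b → 0ℚ < norm ⟨ a , b ⟩ → Nq * (b * b) < a * a
  norm-pos⇒ a b = 0<-⇒<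

  norm-neg⇒ : ∀ a b → norm ⟨ a , b ⟩ < 0ℚ → a * a < Nq * (b * b)
  norm-neg⇒ a b h = 0<-⇒< (subst (0ℚ <_)
    (solve 2 (λ A B → :- (A :- B) := B :- A) refl (a * a) (Nq * (b * b))) (neg-pos h))

  norm-pos⇒re≢0 : ∀ a b → 0ℚ < norm ⟨ a , b ⟩ → a ≢ 0ℚ
  norm-pos⇒re≢0 a b ‖x‖>0 refl = ℚP.<-irrefl refl
    (ℚP.<-≤-trans (norm-pos⇒ 0ℚ b ‖x‖>0) (Nb²-nonneg b))

  norm-neg⇒im≢0 : ∀ a b → norm ⟨ a , b ⟩ < 0ℚ → b ≢ 0ℚ
  norm-neg⇒im≢0 a b ‖x‖<0 refl = ℚP.<-irrefl refl (ℚP.≤-<-trans (square-nonneg a)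
    (subst (a * a <_) (ℚP.*-zeroʳ Nq) (norm-neg⇒ a 0ℚ ‖x‖<0)))

  norm-zero : ∀ x → norm x ≡ 0ℚ → x ≡ 0F
  norm-zero ⟨ a , b ⟩ ‖x‖≡0 = cong₂ ⟨_,_⟩ a≡0 b≡0
    where
      a²≡Nb² : a * a ≡ Nq * (b * b)
      a²≡Nb² = trans (solve 2 (λ A B → A := (A :- B) :+ B) refl (a * a) (Nq * (b * b)))
                 (trans (cong (_+ Nq * (b * b)) ‖x‖≡0) (ℚP.+-identityˡ _))
      b≡0 : b ≡ 0ℚ
      b≡0 = irrational a b a²≡Nb²
      a≡0 : a ≡ 0ℚ
      a≡0 with a ℚP.≟ 0ℚ
      ... | yes a≡0 = a≡0
      ... | no  a≢0 = ⊥-elim (ℚP.<-irrefl refl (subst (0ℚ <_)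
              (trans a²≡Nb² (trans (cong (λ k → Nq * (k * k)) b≡0) (ℚP.*-zeroʳ Nq))) (square-pos a≢0)))

  -- Positivity read off from the norm: if ‖x‖ > 0 the conjugates x, σx
  -- have the same sign, that of their mean a; if ‖x‖ < 0 they have
  -- opposite signs and x > σx, i.e. x > 0, iff b > 0.
  Pos⁺ : QF → Set
  Pos⁺ x = 0ℚ < norm x × 0ℚ < re x

  Pos : QF → Set
  Pos x = Pos⁺ x ⊎ (norm x < 0ℚ × 0ℚ < im x)

  NN : QF → Set
  NN x = x ≡ 0F ⊎ Pos x

  pos-1 : Pos 1F
  pos-1 = inj₁ (subst (0ℚ <_) (sym norm-1) (ℚP.positive⁻¹ 1ℚ) , ℚP.positive⁻¹ 1ℚ)

  ¬pos-0 : ¬ Pos 0F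
  ¬pos-0 (inj₁ (_ , 0<0)) = ℚP.<-irrefl refl 0<0
  ¬pos-0 (inj₂ (_ , 0<0)) = ℚP.<-irrefl refl 0<0

  trichotomy : ∀ x → x ≡ 0F ⊎ Pos x ⊎ Pos (⊖ x)
  trichotomy x@(⟨ a , b ⟩) with ℚP.<-cmp (norm x) 0ℚ
  ... | tri≈ _ ‖x‖≡0 _ = inj₁ (norm-zero x ‖x‖≡0)
  ... | tri> _ _ ‖x‖>0 with ℚP.<-cmp a 0ℚ
  ...   | tri< a<0 _ _ = inj₂ (inj₂ (inj₁ (subst (0ℚ <_) (sym (norm-⊖ x)) ‖x‖>0 , neg-pos a<0)))
  ...   | tri≈ _ a≡0 _ = ⊥-elim (norm-pos⇒re≢0 a b ‖x‖>0 a≡0)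
  ...   | tri> _ _ a>0 = inj₂ (inj₁ (inj₁ (‖x‖>0 , a>0)))
  trichotomy x@(⟨ a , b ⟩) | tri< ‖x‖<0 _ _ with ℚP.<-cmp b 0ℚ
  ...   | tri< b<0 _ _ = inj₂ (inj₂ (inj₂ (subst (_< 0ℚ) (sym (norm-⊖ x)) ‖x‖<0 , neg-pos b<0)))
  ...   | tri≈ _ b≡0 _ = ⊥-elim (norm-neg⇒im≢0 a b ‖x‖<0 b≡0)
  ...   | tri> _ _ b>0 = inj₂ (inj₁ (inj₂ (‖x‖<0 , b>0)))

  -- Positivity is closed under products.  First for Pos⁺, where the real
  -- part ac + Nbd is positive because (ac)² > (Nbd)².
  pos⁺-⊗ : ∀ x y → Pos⁺ x → Pos⁺ y → Pos⁺ (x ⊗ y)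
  pos⁺-⊗ x@(⟨ a , b ⟩) y@(⟨ c , d ⟩) (‖x‖>0 , a>0) (‖y‖>0 , c>0) =
    subst (0ℚ <_) (sym (norm-⊗ x y)) (*-pos ‖x‖>0 ‖y‖>0) ,
    dominates (a * c) (Nq * (b * d)) (*-pos a>0 c>0)
      (subst (0ℚ <_) split (ℚP.+-mono-<-≤ (*-pos ‖x‖>0 (*-pos c>0 c>0)) (*-nonneg (Nb²-nonneg b) (ℚP.<⇒≤ ‖y‖>0))))
    where
      split : (a * a - Nq * (b * b)) * (c * c) + (Nq * (b * b)) * (c * c - Nq * (d * d))
              ≡ (a * c) * (a * c) - (Nq * (b * d)) * (Nq * (b * d))
      split = solve 5 (λ a b c d n →
        (a :* a :- n :* (b :* b)) :* (c :* c) :+ (n :* (b :* b)) :* (c :* c :- n :* (d :* d))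
        := (a :* c) :* (a :* c) :- (n :* (b :* d)) :* (n :* (b :* d))) refl a b c d Nq

  rootN-⊗ : ∀ a b → rootN ⊗ ⟨ a , b ⟩ ≡ ⟨ Nq * b , a ⟩
  rootN-⊗ a b = cong₂ ⟨_,_⟩
    (solve 3 (λ a b n → con 0ℚ :* a :+ n :* (con 1ℚ :* b) := n :* b) refl a b Nq)
    (solve 2 (λ a b → con 0ℚ :* b :+ con 1ℚ :* a := a) refl a b)

  norm-rootN-⊗ : ∀ x → norm (rootN ⊗ x) ≡ - (Nq * norm x)
  norm-rootN-⊗ x = trans (norm-⊗ rootN x)
    (trans (cong (_* norm x) norm-rootN) (sym (ℚP.neg-distribˡ-* Nq (norm x))))

  Nq-*-neg : ∀ {t} → t < 0ℚ → Nq * t < 0ℚ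
  Nq-*-neg {t} t<0 = pos-neg⇒neg (subst (0ℚ <_) (sym (ℚP.neg-distribʳ-* Nq t)) (*-pos Nq-pos (neg-pos t<0)))

  Nq-*-cancel : ∀ {t} → 0ℚ < Nq * t → 0ℚ < t
  Nq-*-cancel {t} h = ℚP.*-cancelˡ-<-nonNeg Nq {{ℚ.nonNegative (ℚP.<⇒≤ Nq-pos)}}
    (subst (_< Nq * t) (sym (ℚP.*-zeroʳ Nq)) h)

  pos⁺-rootN-⊗ : ∀ x → norm x < 0ℚ → 0ℚ < im x → Pos⁺ (rootN ⊗ x)
  pos⁺-rootN-⊗ x@(⟨ a , b ⟩) ‖x‖<0 b>0 =
    subst (0ℚ <_) (sym (norm-rootN-⊗ x)) (neg-pos (Nq-*-neg ‖x‖<0)) ,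
    subst (0ℚ <_) (sym (cong re (rootN-⊗ a b))) (*-pos Nq-pos b>0)

  pos-rootN-⊗⁻¹ : ∀ x → Pos (rootN ⊗ x) → Pos x
  pos-rootN-⊗⁻¹ x@(⟨ a , b ⟩) (inj₁ (‖√Nx‖>0 , re>0)) = inj₂ (‖x‖<0 , b>0)
    where
      ‖x‖<0 : norm x < 0ℚ
      ‖x‖<0 = pos-neg⇒neg (Nq-*-cancel (subst (0ℚ <_)
                (trans (norm-rootN-⊗ x) (ℚP.neg-distribʳ-* Nq (norm x))) ‖√Nx‖>0))
      b>0 : 0ℚ < b
      b>0 = Nq-*-cancel (subst (0ℚ <_) (cong re (rootN-⊗ a b)) re>0)
  pos-rootN-⊗⁻¹ x@(⟨ a , b ⟩) (inj₂ (‖√Nx‖<0 , im>0)) =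
    inj₁ (Nq-*-cancel (neg-neg⇒pos (subst (_< 0ℚ) (norm-rootN-⊗ x) ‖√Nx‖<0)) ,
          subst (0ℚ <_) (cong im (rootN-⊗ a b)) im>0)

  pos-split : ∀ x → Pos x → Pos⁺ x ⊎ Pos⁺ (rootN ⊗ x)
  pos-split x (inj₁ x⁺)           = inj₁ x⁺
  pos-split x (inj₂ (‖x‖<0 , b>0)) = inj₂ (pos⁺-rootN-⊗ x ‖x‖<0 b>0)

  -- The general product reduces to pos⁺-⊗ after multiplying by √N.
  pos-⊗ : ∀ x y → Pos x → Pos y → Pos (x ⊗ y)
  pos-⊗ x y px py with pos-split x px | pos-split y py
  ... | inj₁ x⁺ | inj₁ y⁺ = inj₁ (pos⁺-⊗ x y x⁺ y⁺)
  ... | inj₁ x⁺ | inj₂ y⁺ = pos-rootN-⊗⁻¹ (x ⊗ y)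
          (inj₁ (subst Pos⁺ (⊗-left-comm x rootN y) (pos⁺-⊗ x (rootN ⊗ y) x⁺ y⁺)))
  ... | inj₂ x⁺ | inj₁ y⁺ = pos-rootN-⊗⁻¹ (x ⊗ y)
          (inj₁ (subst Pos⁺ (⊗-assoc rootN x y) (pos⁺-⊗ (rootN ⊗ x) y x⁺ y⁺)))
  ... | inj₂ x⁺ | inj₂ y⁺ = pos-rootN-⊗⁻¹ (x ⊗ y) (pos-rootN-⊗⁻¹ (rootN ⊗ (x ⊗ y))
          (inj₁ (subst Pos⁺ (trans (⊗-interchange rootN x rootN y) (⊗-assoc rootN rootN (x ⊗ y)))
                   (pos⁺-⊗ (rootN ⊗ x) (rootN ⊗ y) x⁺ y⁺))))

  NN⇒NonNeg : ∀ x → NN x → NonNeg x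
  NN⇒NonNeg x (inj₁ refl) = inj₁ (ℚP.≤-refl , ℚP.≤-refl)
  NN⇒NonNeg ⟨ a , b ⟩ (inj₂ (inj₁ (‖x‖>0 , a>0))) with b ℚP.<? 0ℚ
  ... | yes b<0 = inj₂ (inj₁ ((ℚP.<⇒≤ a>0 , b<0) , ℚP.<⇒≤ (norm-pos⇒ a b ‖x‖>0)))
  ... | no  b≮0 = inj₁ (ℚP.<⇒≤ a>0 , ℚP.≮⇒≥ b≮0)
  NN⇒NonNeg ⟨ a , b ⟩ (inj₂ (inj₂ (‖x‖<0 , b>0))) with a ℚP.<? 0ℚ
  ... | yes a<0 = inj₂ (inj₂ ((a<0 , b>0) , ℚP.<⇒≤ (norm-neg⇒ a b ‖x‖<0)))
  ... | no  a≮0 = inj₁ (ℚP.≮⇒≥ a≮0 , ℚP.<⇒≤ b>0)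

  private
    nonneg-re : ∀ a b → NonNeg ⟨ a , b ⟩ → 0ℚ < norm ⟨ a , b ⟩ → 0ℚ ≤ℚ a
    nonneg-re a b (inj₁ (0≤a , _))               _     = 0≤a
    nonneg-re a b (inj₂ (inj₁ ((0≤a , _) , _)))  _     = 0≤a
    nonneg-re a b (inj₂ (inj₂ (_ , a²≤Nb²))) ‖x‖>0 = ⊥-elim (<⇒≱ (norm-pos⇒ a b ‖x‖>0) a²≤Nb²)

    nonneg-im : ∀ a b → NonNeg ⟨ a , b ⟩ → norm ⟨ a , b ⟩ < 0ℚ → 0ℚ ≤ℚ b
    nonneg-im a b (inj₁ (_ , 0≤b))               _     = 0≤b
    nonneg-im a b (inj₂ (inj₁ (_ , Nb²≤a²))) ‖x‖<0 = ⊥-elim (<⇒≱ (norm-neg⇒ a b ‖x‖<0) Nb²≤a²)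
    nonneg-im a b (inj₂ (inj₂ ((_ , b>0) , _)))  _     = ℚP.<⇒≤ b>0

  NonNeg⇒NN : ∀ x → NonNeg x → NN x
  NonNeg⇒NN x@(⟨ a , b ⟩) x≥0 with ℚP.<-cmp (norm x) 0ℚ
  ... | tri≈ _ ‖x‖≡0 _ = inj₁ (norm-zero x ‖x‖≡0)
  ... | tri> _ _ ‖x‖>0 = inj₂ (inj₁ (‖x‖>0 , nonneg∧≢0⇒pos (nonneg-re a b x≥0 ‖x‖>0) (norm-pos⇒re≢0 a b ‖x‖>0)))
  ... | tri< ‖x‖<0 _ _ = inj₂ (inj₂ (‖x‖<0 , nonneg∧≢0⇒pos (nonneg-im a b x≥0 ‖x‖<0) (norm-neg⇒im≢0 a b ‖x‖<0)))

  pos-1⊕ : ∀ z → NN z → Pos (1F ⊕ z)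
  pos-1⊕ z (inj₁ refl) = subst Pos (sym (⊕-identityʳ 1F)) pos-1
  pos-1⊕ z@(⟨ a , b ⟩) (inj₂ z>0) = from-sign z>0
    where
      0<1 : 0ℚ < 1ℚ
      0<1 = ℚP.positive⁻¹ 1ℚ
      norm-1⊕z : norm (1F ⊕ z) ≡ norm z + ((1ℚ + a) + a)
      norm-1⊕z = solve 3 (λ a b n → (con 1ℚ :+ a) :* (con 1ℚ :+ a) :- n :* ((con 0ℚ :+ b) :* (con 0ℚ :+ b))
                   := (a :* a :- n :* (b :* b)) :+ ((con 1ℚ :+ a) :+ a)) refl a b Nq
      a<1+a : a < 1ℚ + a
      a<1+a = subst (_< 1ℚ + a) (ℚP.+-identityˡ a) (ℚP.+-monoˡ-< a 0<1)
      from-sign : Pos z → Pos (1F ⊕ z)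
      from-sign (inj₁ (‖z‖>0 , a>0)) = inj₁
        (subst (0ℚ <_) (sym norm-1⊕z) (ℚP.+-mono-< ‖z‖>0 (ℚP.+-mono-< (ℚP.<-trans a>0 a<1+a) a>0)) ,
         ℚP.<-trans a>0 a<1+a)
      from-sign (inj₂ (‖z‖<0 , b>0)) with (1ℚ + a) ℚP.<? 0ℚ
      ... | yes 1+a<0 = inj₂
        (subst (_< 0ℚ) (sym norm-1⊕z) (ℚP.+-mono-< ‖z‖<0 (ℚP.+-mono-< 1+a<0 (ℚP.<-trans a<1+a 1+a<0))) ,
         subst (0ℚ <_) (sym (ℚP.+-identityˡ b)) b>0)
      ... | no 1+a≮0 with NonNeg⇒NN (1F ⊕ z) (inj₁ (ℚP.≮⇒≥ 1+a≮0 , subst (0ℚ ≤ℚ_) (sym (ℚP.+-identityˡ b)) (ℚP.<⇒≤ b>0)))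
      ...   | inj₁ 1+z≡0 = ⊥-elim (ℚP.<-irrefl refl (subst (0ℚ <_) (trans (sym (ℚP.+-identityˡ b)) (cong im 1+z≡0)) b>0))
      ...   | inj₂ 1+z>0 = 1+z>0

  nn-⊗ : ∀ x y → NN x → NN y → NN (x ⊗ y)
  nn-⊗ x y (inj₁ refl) _           = inj₁ (⊗-zeroˡ y)
  nn-⊗ x y (inj₂ _)    (inj₁ refl) = inj₁ (⊗-zeroʳ x)
  nn-⊗ x y (inj₂ x>0)  (inj₂ y>0)  = inj₂ (pos-⊗ x y x>0 y>0)

  nn-square : ∀ x → NN (x ⊗ x)
  nn-square x with trichotomy x
  ... | inj₁ refl         = inj₁ (⊗-zeroˡ 0F)
  ... | inj₂ (inj₁ x>0)   = inj₂ (pos-⊗ x x x>0 x>0)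
  ... | inj₂ (inj₂ ⊖x>0)  = inj₂ (subst Pos (⊖-square x) (pos-⊗ (⊖ x) (⊖ x) ⊖x>0 ⊖x>0))

  nn⇒¬neg : ∀ w → NN w → ¬ Pos (⊖ w)
  nn⇒¬neg w (inj₁ refl) ⊖w>0 = ¬pos-0 ⊖w>0
  nn⇒¬neg w (inj₂ (inj₁ (_ , a>0))) (inj₁ (_ , -a>0)) = ℚP.<-asym a>0 (pos-neg⇒neg -a>0)
  nn⇒¬neg w (inj₂ (inj₁ (‖w‖>0 , _))) (inj₂ (‖⊖w‖<0 , _)) = ℚP.<-asym ‖w‖>0 (subst (_< 0ℚ) (norm-⊖ w) ‖⊖w‖<0)
  nn⇒¬neg w (inj₂ (inj₂ (‖w‖<0 , _))) (inj₁ (‖⊖w‖>0 , _)) = ℚP.<-asym (subst (0ℚ <_) (norm-⊖ w) ‖⊖w‖>0) ‖w‖<0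
  nn⇒¬neg w (inj₂ (inj₂ (_ , b>0))) (inj₂ (_ , -b>0)) = ℚP.<-asym b>0 (pos-neg⇒neg -b>0)

  nn-cancel : ∀ z c → Pos c → NN (z ⊗ c) → NN z
  nn-cancel z c c>0 zc≥0 with trichotomy z
  ... | inj₁ z≡0        = inj₁ z≡0
  ... | inj₂ (inj₁ z>0) = inj₂ z>0
  ... | inj₂ (inj₂ ⊖z>0) = ⊥-elim (nn⇒¬neg (z ⊗ c) zc≥0
          (subst Pos (sym (-‿distribˡ-* z c)) (pos-⊗ (⊖ z) c ⊖z>0 c>0)))

  pos-inverse : ∀ x y → Pos x → x ⊗ y ≡ 1F → Pos y
  pos-inverse x y x>0 xy≡1 with trichotomy y
  ... | inj₁ refl        = ⊥-elim (¬pos-0 (subst Pos (trans (sym xy≡1) (⊗-zeroʳ x)) pos-1))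
  ... | inj₂ (inj₁ y>0)  = y>0
  ... | inj₂ (inj₂ ⊖y>0) = ⊥-elim (nn⇒¬neg 1F (inj₂ pos-1)
          (subst Pos (trans (sym (-‿distribʳ-* x y)) (cong ⊖_ xy≡1)) (pos-⊗ x (⊖ y) x>0 ⊖y>0)))

  pos-^ℕ : ∀ x n → Pos x → Pos (x ^ℕ n)
  pos-^ℕ x zero    _   = pos-1
  pos-^ℕ x (suc n) x>0 = pos-⊗ x (x ^ℕ n) x>0 (pos-^ℕ x n x>0)

  pos-^ : ∀ x m → Pos x → norm x ≢ 0ℚ → Pos (x ^ m)
  pos-^ x (+ n)    x>0 _     = pos-^ℕ x n x>0
  pos-^ x -[1+ n ] x>0 ‖x‖≢0 = pos-^ℕ (inv x) (suc n) (pos-inverse x (inv x) x>0 (inv-inverse x ‖x‖≢0))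

  pos-rootN : Pos rootN
  pos-rootN = inj₂ (subst (_< 0ℚ) (sym norm-rootN) (neg-neg Nq-pos) , ℚP.positive⁻¹ 1ℚ)

  norm-rootN≢0 : norm rootN ≢ 0ℚ
  norm-rootN≢0 ‖√N‖≡0 = ℚP.<-irrefl refl (subst (_< 0ℚ) (trans (sym norm-rootN) ‖√N‖≡0) (neg-neg Nq-pos))

  one-≤⇒pos : ∀ x → ι 1ℚ ≤F x → Pos x
  one-≤⇒pos x 1≤x = subst Pos (⊕-⊖-cancel x 1F) (pos-1⊕ (x ⊕ (⊖ 1F)) (NonNeg⇒NN _ 1≤x))

  square-multiple-sign : ∀ x y c t → Sign t → y ≤F x → Pos y →
    y ⊗ (c ⊗ c) ≡ ι t ⊗ x → y ⊗ (c ⊗ c) ≡ x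
  square-multiple-sign x y c t (inj₁ refl) _ _ eq = trans eq (⊗-identityˡ x)
  square-multiple-sign x y c t (inj₂ refl) y≤x y>0 eq =
    ⊥-elim (nn⇒¬neg (x ⊕ (⊖ y)) (NonNeg⇒NN _ y≤x)
      (subst Pos y[1+c²]≡y-x (pos-⊗ y (1F ⊕ (c ⊗ c)) y>0 (pos-1⊕ (c ⊗ c) (nn-square c)))))
    where
      y[1+c²]≡y-x : y ⊗ (1F ⊕ (c ⊗ c)) ≡ ⊖ (x ⊕ (⊖ y))
      y[1+c²]≡y-x = begin
        y ⊗ (1F ⊕ (c ⊗ c))           ≡⟨ ⊗-distribˡ-⊕ y 1F (c ⊗ c) ⟩
        (y ⊗ 1F) ⊕ (y ⊗ (c ⊗ c))     ≡⟨ cong₂ _⊕_ (⊗-identityʳ y) eq ⟩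
        y ⊕ (ι (- 1ℚ) ⊗ x)           ≡⟨ cong (y ⊕_) (-1*x≈-x x) ⟩
        y ⊕ (⊖ x)                    ≡⟨ ⊕-⊖-swap x y ⟩
        ⊖ (x ⊕ (⊖ y))                ∎
        where open ≡-Reasoning

  square-≤ : ∀ x y c → ι 1ℚ ≤F y → y ⊗ (c ⊗ c) ≡ x → (c ⊗ c) ≤F x
  square-≤ x y c 1≤y yc²≡x = NN⇒NonNeg _ (subst NN gap (nn-⊗ _ (c ⊗ c) (NonNeg⇒NN _ 1≤y) (nn-square c)))
    where
      gap : (y ⊕ (⊖ 1F)) ⊗ (c ⊗ c) ≡ x ⊕ (⊖ (c ⊗ c))
      gap = trans ([y-z]x≈yx-zx (c ⊗ c) y 1F) (cong₂ (λ a b → a ⊕ (⊖ b)) yc²≡x (⊗-identityˡ (c ⊗ c)))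

  divide-bound : ∀ L u r r' → Pos (u ⊗ r) → r' ⊗ r ≡ 1F →
    (u ⊗ u) ≤F (L ⊗ (u ⊗ r)) → (u ⊗ r') ≤F L
  divide-bound L u r r' ur>0 r'r≡1 u²≤Lur =
    NN⇒NonNeg _ (nn-cancel _ (u ⊗ r) ur>0 (subst NN (sym gap) (NonNeg⇒NN _ u²≤Lur)))
    where
      gap : (L ⊕ (⊖ (u ⊗ r'))) ⊗ (u ⊗ r) ≡ (L ⊗ (u ⊗ r)) ⊕ (⊖ (u ⊗ u))
      gap = begin
        (L ⊕ (⊖ (u ⊗ r'))) ⊗ (u ⊗ r)          ≡⟨ [y-z]x≈yx-zx (u ⊗ r) L (u ⊗ r') ⟩
        (L ⊗ (u ⊗ r)) ⊕ (⊖ ((u ⊗ r') ⊗ (u ⊗ r))) ≡⟨ cong (λ k → (L ⊗ (u ⊗ r)) ⊕ (⊖ k)) (⊗-interchange u r' u r) ⟩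
        (L ⊗ (u ⊗ r)) ⊕ (⊖ ((u ⊗ u) ⊗ (r' ⊗ r))) ≡⟨ cong (λ k → (L ⊗ (u ⊗ r)) ⊕ (⊖ ((u ⊗ u) ⊗ k))) r'r≡1 ⟩
        (L ⊗ (u ⊗ r)) ⊕ (⊖ ((u ⊗ u) ⊗ 1F))    ≡⟨ cong (λ k → (L ⊗ (u ⊗ r)) ⊕ (⊖ k)) (⊗-identityʳ (u ⊗ u)) ⟩
        (L ⊗ (u ⊗ r)) ⊕ (⊖ (u ⊗ u))           ∎
        where open ≡-Reasoning

proposition3p26 : (N : ℕ) → 2 ≤ N → SquareFree N →
    let open QFOps N in
    (ε : QF) → IsFundamentalUnit ε → norm ε ≡ ℚ.- 1ℚ →
    (α : QF) → σ α ≤F α → ι 1ℚ ≤F σ α →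
    (ℓ m : ℤ) (δ : ℕ) → δ ≤ 1 →
    α ≡ ιℤ ℓ ⊗ ((ε ^ m) ⊗ (rootN ^ℕ δ)) →
    ((ε ^ m) ⊗ (rootN ^ (ℤ.- (+ δ)))) ≤F ιℤ ℓ
    × (ε ^ (+ 2 ℤ.* m)) ≤F α
proposition3p26 N N≥2 sf ε (_ , (1≤ε , _) , _) ‖ε‖≡-1 α σα≤α 1≤σα ℓ m δ _ α≡ℓur =
  divide-bound (ιℤ ℓ) u r (rootN ^ (ℤ.- (+ δ))) (pos-⊗ u r u>0 r>0) (^-neg-cancel rootN δ norm-rootN≢0)
    (subst ((u ⊗ u) ≤F_) α≡ℓur u²≤α) ,
  subst (_≤F α) (sym (^-double ε m)) u²≤α
  where
    open QFOps N
    open Arithmetic N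
    open Powers N
    open Order N N≥2 sf
    u = ε ^ m
    r = rootN ^ℕ δ
    ‖ε‖±1 : Sign (norm ε)
    ‖ε‖±1 = inj₂ ‖ε‖≡-1
    u>0 : Pos u
    u>0 = pos-^ ε m (one-≤⇒pos ε 1≤ε) (Sign≢0 ‖ε‖±1)
    r>0 : Pos r
    r>0 = pos-^ℕ rootN δ pos-rootN
    σα·u²≡α : σ α ⊗ (u ⊗ u) ≡ α
    σα·u²≡α with σ-rootN^ℕ δ
    ... | s , s±1 , σr≡sr = square-multiple-sign α (σ α) u (norm u * s)
            (Sign-* (Sign-norm-^ ε m ‖ε‖±1) s±1) σα≤α (one-≤⇒pos (σ α) 1≤σα)
            (subst (λ a → σ a ⊗ (u ⊗ u) ≡ ι (norm u * s) ⊗ a) (sym α≡ℓur)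
              (conjugate-times-square (ιℤ ℓ) u r s refl σr≡sr))
    u²≤α : (u ⊗ u) ≤F α
    u²≤α = square-≤ α (σ α) u 1≤σα σα·u²≡α
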